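{- Let $G$ be a connected graph of order $n_1$ and let $n$ be an integer. If $n\ge 2n_1\ge 4$ or $n>2n_1=2$, then $pd(G\odot K_{1,n})=n$.
   Context: $K_{1,n}$ is the star with $n$ leaves. For a connected graph $F$ and an ordered partition $\Pi=\{P_1,\dots,P_t\}$ of $V(F)$, $r(v|\Pi)=(d(v,P_1),\dots,d(v,P_t))$ where $d$ is shortest-path distance and $d(v,P_i)=\min_{u\in P_i}d(v,u)$; $\Pi$ is a resolving partition if $r(u|\Pi)\ne r(v|\Pi)$ for all distinct vertices $u,v$; $pd(F)$ is the minimum number of sets in a resolving partition. For graphs $G$ of order $n_1$ (vertices $v_1,\dots,v_{n_1}$) and $H$, the corona product $G\odot H$ is obtained from one copy of $G$ and $n_1$ copies $H_1,\dots,H_{n_1}$ of $H$ by joining $v_i$ to every vertex of $H_i$. -}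

module Defs where

open import Data.Nat using (ℕ; zero; suc; _≤_; _<_)
open import Data.Fin using (Fin)
open import Data.Sum using (_⊎_; inj₁; inj₂)
open import Data.Product using (Σ; _×_; _,_; ∃; ∃-syntax)
open import Data.Empty using (⊥)
open import Relation.Nullary using (¬_)
open import Relation.Binary.PropositionalEquality using (_≡_; _≢_)
open import Function.Definitions using (Surjective)

record Graph (V : Set) : Set₁ where
  field
    Adj    : V → V → Set
    sym    : ∀ {x y} → Adj x y → Adj y x
    irrefl : ∀ {x} → ¬ Adj x x
open Graph public

data Walk {V : Set} (G : Graph V) : V → V → ℕ → Set where
  here : ∀ {x} → Walk G x x zero
  step : ∀ {x y z k} → Adj G x y → Walk G y z k → Walk G x z (suc k)

Connected : {V : Set} → Graph V → Set
Connected G = ∀ u v → ∃[ k ] Walk G u v k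

IsDist : {V : Set} → Graph V → V → V → ℕ → Set
IsDist G u v k = Walk G u v k × (∀ j → j < k → ¬ Walk G u v j)

-- An ordered partition {P_1,...,P_t} of V into t nonempty classes,
-- given by the class map c (P_i = c⁻¹(i)); surjectivity = classes nonempty.
record OrdPartition (V : Set) (t : ℕ) : Set where
  field
    cls       : V → Fin t
    nonempty  : ∀ i → ∃[ v ] cls v ≡ i
open OrdPartition public

IsSetDist : {V : Set} → Graph V → {t : ℕ} → OrdPartition V t → V → Fin t → ℕ → Set
IsSetDist G Π v i k =
  (∃[ u ] (cls Π u ≡ i × IsDist G v u k)) ×
  (∀ u j → cls Π u ≡ i → IsDist G v u j → k ≤ j)

IsRep : {V : Set} → Graph V → {t : ℕ} → OrdPartition V t → V → (Fin t → ℕ) → Set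
IsRep G Π v r = ∀ i → IsSetDist G Π v i (r i)

Resolving : {V : Set} → Graph V → {t : ℕ} → OrdPartition V t → Set
Resolving G Π = ∀ u w → u ≢ w → ∀ ru rw → IsRep G Π u ru → IsRep G Π w rw →
  ¬ (∀ i → ru i ≡ rw i)

PartitionDim : {V : Set} → Graph V → ℕ → Set
PartitionDim G p =
  (Σ (OrdPartition _ p) λ Π → Resolving G Π) ×
  (∀ t → t < p → (Π : OrdPartition _ t) → ¬ Resolving G Π)

-- Star K_{1,n}: vertex 0 is the centre, vertices 1..n are leaves.
star : (n : ℕ) → Graph (Fin (suc n))
star n = record { Adj = A ; sym = λ {x} {y} → s {x} {y} ; irrefl = λ {x} → ir {x} }
  where
    A : Fin (suc n) → Fin (suc n) → Set
    A x y = (x ≡ Fin.zero × y ≢ Fin.zero) ⊎ (y ≡ Fin.zero × x ≢ Fin.zero)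
    s : ∀ {x y} → A x y → A y x
    s (inj₁ p) = inj₂ p
    s (inj₂ p) = inj₁ p
    ir : ∀ {x} → ¬ A x x
    ir (inj₁ (p , q)) = q p
    ir (inj₂ (p , q)) = q p

-- Corona product G ⊙ H: vertices inj₁ a (copy of G) and inj₂ (a , h)
-- (vertex h of the copy H_a attached to a).
corona : {V W : Set} → Graph V → Graph W → Graph (V ⊎ (V × W))
corona {V} {W} G H = record { Adj = A ; sym = λ {x} {y} → s {x} {y} ; irrefl = λ {x} → ir {x} }
  where
    A : V ⊎ (V × W) → V ⊎ (V × W) → Set
    A (inj₁ a) (inj₁ b) = Adj G a b
    A (inj₁ a) (inj₂ (b , h)) = a ≡ b
    A (inj₂ (a , h)) (inj₁ b) = a ≡ b
    A (inj₂ (a , h)) (inj₂ (b , h')) = a ≡ b × Adj H h h'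
    s : ∀ {x y} → A x y → A y x
    s {inj₁ a} {inj₁ b} p = Graph.sym G p
    s {inj₁ a} {inj₂ _} p = Relation.Binary.PropositionalEquality.sym p
    s {inj₂ _} {inj₁ b} p = Relation.Binary.PropositionalEquality.sym p
    s {inj₂ _} {inj₂ _} (p , q) = Relation.Binary.PropositionalEquality.sym p , Graph.sym H q
    ir : ∀ {x} → ¬ A x x
    ir {inj₁ a} p = irrefl G p
    ir {inj₂ _} (_ , q) = irrefl H q

module Submission where

-- Fix an injective labelling ℓ of the 2n₁ "hubs" of C (the
-- vertices v_a of G and the star centres c_a) by classes 0..n-1 (possible as
-- 2n₁ ≤ n), and put the j-th leaf of every copy into class j.  Two vertices
-- in different classes are told apart by the distance 0 to their own class.
-- Two distinct vertices in the same class are told apart by a class at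
-- distance ≤ 1 from one of them but not from the other: a hub is within
-- distance 1 of every class, whereas the j-th leaf of copy b only sees the
-- classes j, ℓ(v_b), ℓ(c_b); here n ≥ 3 and injectivity of ℓ give the choice.
--
-- With fewer than n classes two leaves of one copy share a
-- class (pigeonhole); transposing them is an automorphism of C preserving
-- every class, hence preserving representations, so they are not resolved.

open import Defs hiding (sym)
open import Data.Nat using (ℕ; zero; suc; _+_; _*_; _≤_; _<_; z≤n; s≤s)
open import Data.Nat.Properties using (≤-trans; ≮⇒≥; +-identityʳ; n≤1+n)
open import Data.Nat.Induction using (<-rec)
open import Data.Fin using (Fin; join; inject≤)
import Data.Fin as F
open import Data.Fin.Properties
  using (_≟_; pigeonhole; <⇒≢; inject≤-injective; splitAt-join; sequence)
open import Data.Fin.Permutation using (Permutation; _⟨$⟩ʳ_; _⟨$⟩ˡ_; inverseˡ; inverseʳ; transpose)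
import Data.Fin.Permutation.Components as PC
open import Data.Sum using (_⊎_; inj₁; inj₂; reduce; swap)
open import Data.Product using (Σ; _×_; _,_; proj₁; proj₂; ∃-syntax)
open import Data.Empty using (⊥-elim)
open import Effect.Monad using (RawMonad)
open import Function.Definitions using (Injective)
open import Relation.Nullary using (¬_; yes; no)
open import Relation.Nullary.Negation using (¬¬-Monad; contradiction)
open import Relation.Binary.Definitions using (DecidableEquality)
open import Relation.Binary.PropositionalEquality

-- Classical existence statements hold here only up to double negation;
-- that suffices, as they are only used to refute resolvability.

-- Least number principle: if some number satisfies Q, then (classically)
-- a least one does.  Needed to turn walks into shortest paths.
¬¬-least : (Q : ℕ → Set) {m : ℕ} → Q m →
           ¬ ¬ (∃[ k ] (Q k × (∀ j → j < k → ¬ Q j)))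
¬¬-least Q {m} qm noLeast =
  <-rec (λ j → ¬ Q j) (λ j below qj → noLeast (j , qj , λ i i<j → below i<j)) m qm

¬¬-finite : {t : ℕ} {P : Fin t → Set} → (∀ i → ¬ ¬ P i) → ¬ ¬ (∀ i → P i)
¬¬-finite = sequence (RawMonad.rawApplicative ¬¬-Monad)

mapWalk : {V W : Set} {F : Graph V} {F′ : Graph W} (f : V → W) →
          (∀ {x y} → Adj F x y → Adj F′ (f x) (f y)) →
          ∀ {x y k} → Walk F x y k → Walk F′ (f x) (f y) k
mapWalk f f-adj here       = here
mapWalk f f-adj (step a w) = step (f-adj a) (mapWalk f f-adj w)

module WalkFacts {V : Set} (F : Graph V) where

  walk-zero : ∀ {x y} → Walk F x y 0 → x ≡ y
  walk-zero here = refl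

  walk-one : ∀ {x y} → Walk F x y 1 → Adj F x y
  walk-one (step a here) = a

  _++ʷ_ : ∀ {x y z k l} → Walk F x y k → Walk F y z l → Walk F x z (k + l)
  here     ++ʷ w = w
  step a v ++ʷ w = step a (v ++ʷ w)

  dist-refl : ∀ x → IsDist F x x 0
  dist-refl x = here , λ _ ()

  dist-adj : ∀ {x y} → Adj F x y → IsDist F x y 1
  dist-adj {x} a = step a here , λ where
    zero    _         w → irrefl F (subst (Adj F x) (sym (walk-zero w)) a)
    (suc j) (s≤s ())

record Automorphism {V : Set} (F : Graph V) : Set where
  field
    to       : V → V
    from     : V → V
    from-to  : ∀ x → from (to x) ≡ x
    to-from  : ∀ x → to (from x) ≡ x
    to-adj   : ∀ {x y} → Adj F x y → Adj F (to x) (to y)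
    from-adj : ∀ {x y} → Adj F x y → Adj F (from x) (from y)
open Automorphism

inverse : {V : Set} {F : Graph V} → Automorphism F → Automorphism F
inverse σ = record { to = from σ ; from = to σ ; from-to = to-from σ ; to-from = from-to σ
                   ; to-adj = from-adj σ ; from-adj = to-adj σ }

-- Automorphisms preserve distances: walks are carried forwards by `to`,
-- and shorter walks between the images are carried back by `from`.
aut-dist : {V : Set} {F : Graph V} (σ : Automorphism F) →
           ∀ {x y k} → IsDist F x y k → IsDist F (to σ x) (to σ y) k
aut-dist {F = F} σ {x} {y} (w , shortest) =
  mapWalk (to σ) (to-adj σ) w ,
  λ j j<k w′ → shortest j j<k
    (subst₂ (λ u v → Walk F u v j) (from-to σ x) (from-to σ y)
      (mapWalk (from σ) (from-adj σ) w′))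

module PartitionFacts {V : Set} (F : Graph V) {t : ℕ} (Π : OrdPartition V t) where
  open WalkFacts F

  Near : V → Fin t → Set
  Near x k = Σ V λ u → cls Π u ≡ k × (u ≡ x ⊎ Adj F x u)

  near⇒≤1 : ∀ {x k d} → Near x k → IsSetDist F Π x k d → d ≤ 1
  near⇒≤1 (u , cu , inj₁ refl) (_ , least) = ≤-trans (least u 0 cu (dist-refl u)) z≤n
  near⇒≤1 (u , cu , inj₂ a)    (_ , least) = least u 1 cu (dist-adj a)

  ≤1⇒near : ∀ {x k d} → IsSetDist F Π x k d → d ≤ 1 → Near x k
  ≤1⇒near {d = zero}        ((u , cu , w , _) , _) _ = u , cu , inj₁ (sym (walk-zero w))
  ≤1⇒near {d = suc zero}    ((u , cu , w , _) , _) _ = u , cu , inj₂ (walk-one w)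
  ≤1⇒near {d = suc (suc d)} _ (s≤s ())

  own-class-0 : ∀ {x d} → IsSetDist F Π x (cls Π x) d → d ≡ 0
  own-class-0 {x} (_ , least) with least x 0 refl (dist-refl x)
  ... | z≤n = refl

  0⇒own-class : ∀ {x k} → IsSetDist F Π x k 0 → cls Π x ≡ k
  0⇒own-class ((u , cu , w , _) , _) = subst (λ v → cls Π v ≡ _) (sym (walk-zero w)) cu

  class-separates : ∀ {x y rx ry} → cls Π x ≢ cls Π y →
                    IsRep F Π x rx → IsRep F Π y ry → ¬ (∀ i → rx i ≡ ry i)
  class-separates {x} {y} x≁y repx repy same =
    x≁y (sym (0⇒own-class (subst (IsSetDist F Π y (cls Π x)) y-dist (repy (cls Π x)))))
    where
      y-dist = trans (sym (same (cls Π x))) (own-class-0 (repx (cls Π x)))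

  near-separates : ∀ {x y rx ry} k → Near x k → ¬ Near y k →
                   IsRep F Π x rx → IsRep F Π y ry → ¬ (∀ i → rx i ≡ ry i)
  near-separates k near-x far-y repx repy same =
    far-y (≤1⇒near (repy k) (subst (_≤ 1) (same k) (near⇒≤1 near-x (repx k))))

  -- In a connected graph every distance to a class exists (classically):
  -- it is the least length of a walk from x into that class.
  setDist-exists : Connected F → ∀ x i → ¬ ¬ (Σ ℕ (IsSetDist F Π x i))
  setDist-exists connected x i noDist with nonempty Π i
  ... | v , cv = ¬¬-least WalkInto (v , cv , proj₂ (connected x v))
                   λ (k , (y , cy , w) , minimal) → noDist (k , witness k y cy w minimal ,
                     λ u j cu d → ≮⇒≥ (λ j<k → minimal j j<k (u , cu , proj₁ d)))
    where
      WalkInto : ℕ → Set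
      WalkInto k = Σ V λ y → cls Π y ≡ i × Walk F x y k
      witness : ∀ k y → cls Π y ≡ i → (w : Walk F x y k) → (∀ j → j < k → ¬ WalkInto j) →
                ∃[ y ] (cls Π y ≡ i × IsDist F x y k)
      witness k y cy w minimal = y , cy , w , λ j j<k w′ → minimal j j<k (y , cy , w′)

  rep-exists : Connected F → ∀ x → ¬ ¬ (Σ (Fin t → ℕ) (IsRep F Π x))
  rep-exists connected x noRep =
    ¬¬-finite (setDist-exists connected x) λ dists →
      noRep ((λ i → proj₁ (dists i)) , λ i → proj₂ (dists i))

  aut-rep : (σ : Automorphism F) → (∀ x → cls Π (to σ x) ≡ cls Π x) →
            ∀ {x r} → IsRep F Π x r → IsRep F Π (to σ x) r
  aut-rep σ keeps {x} rep i with rep i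
  ... | (y , cy , dy) , least =
    (to σ y , trans (keeps y) cy , aut-dist σ dy) ,
    λ u j cu du → least (from σ u) j (class-back u cu)
      (subst (λ v → IsDist F v (from σ u) j) (from-to σ x) (aut-dist (inverse σ) du))
    where
      class-back : ∀ u → cls Π u ≡ i → cls Π (from σ u) ≡ i
      class-back u cu = trans (sym (keeps (from σ u))) (trans (cong (cls Π) (to-from σ u)) cu)

  moved⇒not-resolving : Connected F → (σ : Automorphism F) →
                        (∀ x → cls Π (to σ x) ≡ cls Π x) →
                        ∀ u → u ≢ to σ u → ¬ Resolving F Π
  moved⇒not-resolving connected σ keeps u moved resolving =
    rep-exists connected u λ (r , rep) →
      resolving u (to σ u) moved r r rep (aut-rep σ keeps rep) (λ _ → refl)

leafMap : {n : ℕ} → (Fin n → Fin n) → Fin (suc n) → Fin (suc n)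
leafMap f F.zero    = F.zero
leafMap f (F.suc j) = F.suc (f j)

leafMap-adj : {n : ℕ} (f : Fin n → Fin n) →
              ∀ {h h′} → Adj (star n) h h′ → Adj (star n) (leafMap f h) (leafMap f h′)
leafMap-adj f {F.zero} {F.suc _} _ = inj₁ (refl , λ ())
leafMap-adj f {F.suc _} {F.zero} _ = inj₂ (refl , λ ())
leafMap-adj f {F.zero} {F.zero} a = ⊥-elim (irrefl (star _) a)
leafMap-adj f {F.suc _} {F.suc _} (inj₁ (() , _))
leafMap-adj f {F.suc _} {F.suc _} (inj₂ (() , _))

leafMap-inverse : {n : ℕ} (f g : Fin n → Fin n) → (∀ j → g (f j) ≡ j) →
                  ∀ h → leafMap g (leafMap f h) ≡ h
leafMap-inverse f g gf F.zero    = refl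
leafMap-inverse f g gf (F.suc j) = cong F.suc (gf j)

permuteLeaves : {n : ℕ} → Permutation n n → Automorphism (star n)
permuteLeaves π = record
  { to       = leafMap (π ⟨$⟩ʳ_)
  ; from     = leafMap (π ⟨$⟩ˡ_)
  ; from-to  = leafMap-inverse (π ⟨$⟩ʳ_) (π ⟨$⟩ˡ_) (λ _ → inverseˡ π)
  ; to-from  = leafMap-inverse (π ⟨$⟩ˡ_) (π ⟨$⟩ʳ_) (λ _ → inverseʳ π)
  ; to-adj   = leafMap-adj (π ⟨$⟩ʳ_)
  ; from-adj = leafMap-adj (π ⟨$⟩ˡ_)
  }

transpose-hit : {n : ℕ} (i j : Fin n) → PC.transpose i j i ≡ j
transpose-hit i j with i ≟ i
... | yes _   = refl
... | no i≢i = contradiction refl i≢i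

transpose-invariant : {n : ℕ} {A : Set} (f : Fin n → A) {i j : Fin n} → f i ≡ f j →
                      ∀ k → f (PC.transpose i j k) ≡ f k
transpose-invariant f {i} {j} fi≡fj k with k ≟ i
... | yes refl = sym fi≡fj
... | no _ with k ≟ j
...   | yes refl = fi≡fj
...   | no _     = refl

module CoronaFacts {V W : Set} (G : Graph V) (H : Graph W) where
  open WalkFacts (corona G H)

  base : V ⊎ (V × W) → V
  base (inj₁ a)       = a
  base (inj₂ (a , _)) = a

  to-base : ∀ x → ∃[ k ] Walk (corona G H) x (inj₁ (base x)) k
  to-base (inj₁ a)       = 0 , here
  to-base (inj₂ (a , h)) = 1 , step refl here

  from-base : ∀ x → ∃[ k ] Walk (corona G H) (inj₁ (base x)) x k
  from-base (inj₁ a)       = 0 , here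
  from-base (inj₂ (a , h)) = 1 , step refl here

  corona-connected : Connected G → Connected (corona G H)
  corona-connected connected x y =
    _ , proj₂ (to-base x) ++ʷ (mapWalk inj₁ (λ a → a) (proj₂ (connected (base x) (base y)))
                                 ++ʷ proj₂ (from-base y))

  module _ (_≟V_ : DecidableEquality V) (c : V) where

    inCopy : (W → W) → V → W → W
    inCopy f b h with b ≟V c
    ... | yes _ = f h
    ... | no _  = h

    onCopy : (W → W) → V ⊎ (V × W) → V ⊎ (V × W)
    onCopy f (inj₁ a)       = inj₁ a
    onCopy f (inj₂ (b , h)) = inj₂ (b , inCopy f b h)

    onCopy-inverse : (f g : W → W) → (∀ h → g (f h) ≡ h) →
                     ∀ x → onCopy g (onCopy f x) ≡ x
    onCopy-inverse f g gf (inj₁ a) = refl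
    onCopy-inverse f g gf (inj₂ (b , h)) with b ≟V c
    ... | yes _ = cong (λ h′ → inj₂ (b , h′)) (gf h)
    ... | no _  = refl

    onCopy-adj : (f : W → W) → (∀ {h h′} → Adj H h h′ → Adj H (f h) (f h′)) →
                 ∀ {x y} → Adj (corona G H) x y → Adj (corona G H) (onCopy f x) (onCopy f y)
    onCopy-adj f f-adj {inj₁ _} {inj₁ _} a = a
    onCopy-adj f f-adj {inj₁ _} {inj₂ _} a = a
    onCopy-adj f f-adj {inj₂ _} {inj₁ _} a = a
    onCopy-adj f f-adj {inj₂ (b , h)} {inj₂ (.b , h′)} (refl , a) with b ≟V c
    ... | yes _ = refl , f-adj a
    ... | no _  = refl , a

    autOnCopy : Automorphism H → Automorphism (corona G H)
    autOnCopy τ = record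
      { to       = onCopy (to τ)
      ; from     = onCopy (from τ)
      ; from-to  = onCopy-inverse (to τ) (from τ) (from-to τ)
      ; to-from  = onCopy-inverse (from τ) (to τ) (to-from τ)
      ; to-adj   = λ {x} {y} → onCopy-adj (to τ) (to-adj τ) {x} {y}
      ; from-adj = λ {x} {y} → onCopy-adj (from τ) (from-adj τ) {x} {y}
      }

module LowerBound {n₁ n : ℕ} (G : Graph (Fin n₁)) (connected : Connected G) (c : Fin n₁) where
  open CoronaFacts G (star n)

  Vertex : Set
  Vertex = Fin n₁ ⊎ (Fin n₁ × Fin (suc n))

  leaf : Fin n₁ → Fin n → Vertex
  leaf a j = inj₂ (a , F.suc j)

  leaf-injective : ∀ {a j j′} → leaf a j ≡ leaf a j′ → j ≡ j′
  leaf-injective refl = refl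

  swapLeaves : Fin n → Fin n → Automorphism (corona G (star n))
  swapLeaves j j′ = autOnCopy _≟_ c (permuteLeaves (transpose j j′))

  swapLeaves-moves : ∀ j j′ → to (swapLeaves j j′) (leaf c j) ≡ leaf c j′
  swapLeaves-moves j j′ with c ≟ c
  ... | yes _  = cong (leaf c) (transpose-hit j j′)
  ... | no c≢c = contradiction refl c≢c

  swapLeaves-keeps : ∀ {t} (Π : OrdPartition Vertex t) {j j′} →
                     cls Π (leaf c j) ≡ cls Π (leaf c j′) →
                     ∀ x → cls Π (to (swapLeaves j j′) x) ≡ cls Π x
  swapLeaves-keeps Π same (inj₁ a) = refl
  swapLeaves-keeps Π same (inj₂ (b , h)) with b ≟ c
  ... | yes refl = in-copy h
    where
      in-copy : ∀ h → cls Π (inj₂ (c , leafMap (PC.transpose _ _) h)) ≡ cls Π (inj₂ (c , h))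
      in-copy F.zero    = refl
      in-copy (F.suc k) = transpose-invariant (λ k → cls Π (leaf c k)) same k
  ... | no _     = refl

  few-classes-not-resolving : ∀ {t} → t < n → (Π : OrdPartition Vertex t) →
                              ¬ Resolving (corona G (star n)) Π
  few-classes-not-resolving t<n Π with pigeonhole t<n (λ j → cls Π (leaf c j))
  ... | j , j′ , j<j′ , same =
    PartitionFacts.moved⇒not-resolving (corona G (star n)) Π
      (corona-connected connected) (swapLeaves j j′) (swapLeaves-keeps Π same) (leaf c j)
      (λ e → <⇒≢ j<j′ (leaf-injective (trans e (swapLeaves-moves j j′))))

avoid-two : {n : ℕ} → 3 ≤ n → (x y : Fin n) → ∃[ k ] (k ≢ x × k ≢ y)
avoid-two (s≤s (s≤s (s≤s _))) (F.suc x) (F.suc y) = F.zero , (λ ()) , (λ ())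
avoid-two (s≤s (s≤s (s≤s _))) F.zero F.zero = F.suc F.zero , (λ ()) , (λ ())
avoid-two (s≤s (s≤s (s≤s _))) F.zero (F.suc F.zero) = F.suc (F.suc F.zero) , (λ ()) , (λ ())
avoid-two (s≤s (s≤s (s≤s _))) F.zero (F.suc (F.suc y)) = F.suc F.zero , (λ ()) , (λ ())
avoid-two (s≤s (s≤s (s≤s _))) (F.suc F.zero) F.zero = F.suc (F.suc F.zero) , (λ ()) , (λ ())
avoid-two (s≤s (s≤s (s≤s _))) (F.suc (F.suc x)) F.zero = F.suc F.zero , (λ ()) , (λ ())

join-injective : ∀ m n → Injective _≡_ _≡_ (join m n)
join-injective m n {p} {q} e = begin
  p                         ≡⟨ sym (splitAt-join m n p) ⟩
  F.splitAt m (join m n p)  ≡⟨ cong (F.splitAt m) e ⟩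
  F.splitAt m (join m n q)  ≡⟨ splitAt-join m n q ⟩
  q                         ∎
  where open ≡-Reasoning

hub-labelling : {n₁ n : ℕ} → 2 * n₁ ≤ n → Σ (Fin n₁ ⊎ Fin n₁ → Fin n) (Injective _≡_ _≡_)
hub-labelling {n₁} 2n₁≤n =
  (λ p → inject≤ (join n₁ n₁ p) bound) ,
  λ e → join-injective n₁ n₁ (inject≤-injective bound bound _ _ e)
  where
    bound = subst (λ m → n₁ + m ≤ _) (+-identityʳ n₁) 2n₁≤n

-- The two hubs of a copy: swapping sides changes the hub, not the copy.
swap-moves : {A : Set} (p : A ⊎ A) → swap p ≢ p
swap-moves (inj₁ _) ()
swap-moves (inj₂ _) ()

reduce-swap : {A : Set} (p : A ⊎ A) → reduce (swap p) ≡ reduce p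
reduce-swap (inj₁ _) = refl
reduce-swap (inj₂ _) = refl

module UpperBound {n₁ n : ℕ} (G : Graph (Fin n₁)) (c : Fin n₁)
                  (ℓ : Fin n₁ ⊎ Fin n₁ → Fin n) (ℓ-injective : Injective _≡_ _≡_ ℓ)
                  (3≤n : 3 ≤ n) where

  Vertex : Set
  Vertex = Fin n₁ ⊎ (Fin n₁ × Fin (suc n))

  hub : Fin n₁ ⊎ Fin n₁ → Vertex
  hub (inj₁ a) = inj₁ a
  hub (inj₂ a) = inj₂ (a , F.zero)

  leaf : Fin n₁ → Fin n → Vertex
  leaf a j = inj₂ (a , F.suc j)

  data Shape : Vertex → Set where
    hub-shape  : ∀ p → Shape (hub p)
    leaf-shape : ∀ a j → Shape (leaf a j)

  shape : ∀ x → Shape x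
  shape (inj₁ a)             = hub-shape (inj₁ a)
  shape (inj₂ (a , F.zero))  = hub-shape (inj₂ a)
  shape (inj₂ (a , F.suc j)) = leaf-shape a j

  class : Vertex → Fin n
  class (inj₁ a)             = ℓ (inj₁ a)
  class (inj₂ (a , F.zero))  = ℓ (inj₂ a)
  class (inj₂ (a , F.suc j)) = j

  class-hub : ∀ p → class (hub p) ≡ ℓ p
  class-hub (inj₁ _) = refl
  class-hub (inj₂ _) = refl

  Π : OrdPartition Vertex n
  Π = record { cls = class ; nonempty = λ i → leaf c i , refl }

  open PartitionFacts (corona G (star n)) Π

  other-copy : ∀ {p q} → reduce p ≢ reduce q → ℓ p ≢ ℓ q
  other-copy p≁q e = p≁q (cong reduce (ℓ-injective e))

  -- A hub is adjacent to all leaves of its copy, hence near every class.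
  hub-near : ∀ p k → Near (hub p) k
  hub-near (inj₁ a) k = leaf a k , refl , inj₂ refl
  hub-near (inj₂ a) k = leaf a k , refl , inj₂ (refl , inj₁ (refl , λ ()))

  leaf-near-hub : ∀ p j → Near (leaf (reduce p) j) (ℓ p)
  leaf-near-hub (inj₁ a) j = hub (inj₁ a) , refl , inj₂ refl
  leaf-near-hub (inj₂ a) j = hub (inj₂ a) , refl , inj₂ (refl , inj₂ (refl , λ ()))

  leaf-far : ∀ b j k → k ≢ j → k ≢ ℓ (inj₁ b) → k ≢ ℓ (inj₂ b) → ¬ Near (leaf b j) k
  leaf-far b j k k≢j _ _ (_ , refl , inj₁ refl) = k≢j refl
  leaf-far b j k _ k≢v _ (inj₁ _ , refl , inj₂ refl) = k≢v refl
  leaf-far b j k _ _ k≢c (inj₂ (_ , F.zero) , refl , inj₂ (refl , inj₂ _)) = k≢c refl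
  leaf-far b j k _ _ _ (inj₂ (_ , F.zero) , _ , inj₂ (refl , inj₁ (() , _)))
  leaf-far b j k _ _ _ (inj₂ (_ , F.suc _) , _ , inj₂ (refl , inj₁ (() , _)))
  leaf-far b j k _ _ _ (inj₂ (_ , F.suc _) , _ , inj₂ (refl , inj₂ (() , _)))

  same-copy : ∀ p {k} → k ≢ ℓ (inj₁ (reduce p)) → k ≢ ℓ (inj₂ (reduce p)) → k ≢ ℓ p
  same-copy (inj₁ _) k≢v _ = k≢v
  same-copy (inj₂ _) _ k≢c = k≢c

  Separated : Vertex → Vertex → Set
  Separated x y = Σ (Fin n) λ k → Near x k × ¬ Near y k

  -- A class different from the label of p and from both labels of copy b:
  -- the label of the other hub of p's copy if that copy is not b, and
  -- otherwise one of the n ≥ 3 classes avoiding the two labels of copy b.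
  avoid-labels : ∀ p b → ∃[ k ] (k ≢ ℓ p × k ≢ ℓ (inj₁ b) × k ≢ ℓ (inj₂ b))
  avoid-labels p b with reduce p ≟ b
  ... | no p≁b = ℓ (swap p) , (λ e → swap-moves p (ℓ-injective e)) , other-copy swap≁b , other-copy swap≁b
    where
      swap≁b : reduce (swap p) ≢ b
      swap≁b e = p≁b (trans (sym (reduce-swap p)) e)
  ... | yes refl with avoid-two 3≤n (ℓ (inj₁ (reduce p))) (ℓ (inj₂ (reduce p)))
  ...   | k , k≢v , k≢c = k , same-copy p k≢v k≢c , k≢v , k≢c

  own-label : ∀ a j → ∃[ p ] (reduce p ≡ a × ℓ p ≢ j)
  own-label a j with ℓ (inj₁ a) ≟ j
  ... | no v≢j = inj₁ a , refl , v≢j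
  ... | yes v≡j = inj₂ a , refl , λ c≡j → swap-moves (inj₁ a) (ℓ-injective (trans c≡j (sym v≡j)))

  hub-leaf : ∀ p b j → j ≡ ℓ p → Separated (hub p) (leaf b j)
  hub-leaf p b j refl with avoid-labels p b
  ... | k , k≢p , k≢v , k≢c = k , hub-near p k , leaf-far b (ℓ p) k k≢p k≢v k≢c

  leaf-leaf : ∀ a b j → a ≢ b → Separated (leaf a j) (leaf b j)
  leaf-leaf a b j a≢b with own-label a j
  ... | p , refl , ℓp≢j = ℓ p , leaf-near-hub p j , leaf-far b j (ℓ p) ℓp≢j (other-copy a≢b) (other-copy a≢b)

  separate : ∀ x y → x ≢ y → class x ≡ class y → Separated x y ⊎ Separated y x
  separate x y x≢y same with shape x | shape y
  ... | hub-shape p | hub-shape q =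
    contradiction (cong hub (ℓ-injective (trans (sym (class-hub p)) (trans same (class-hub q))))) x≢y
  ... | hub-shape p | leaf-shape b j = inj₁ (hub-leaf p b j (trans (sym same) (class-hub p)))
  ... | leaf-shape a j | hub-shape q = inj₂ (hub-leaf q a j (trans same (class-hub q)))
  ... | leaf-shape a j | leaf-shape b j′ with a ≟ b | same
  ...   | yes refl | refl = contradiction refl x≢y
  ...   | no a≢b   | refl = inj₁ (leaf-leaf a b j a≢b)

  resolving : Resolving (corona G (star n)) Π
  resolving x y x≢y rx ry repx repy with class x ≟ class y
  ... | no x≁y = class-separates x≁y repx repy
  ... | yes same with separate x y x≢y same
  ...   | inj₁ (k , near-x , far-y) = near-separates k near-x far-y repx repy
  ...   | inj₂ (k , near-y , far-x) = λ eq → near-separates k near-y far-x repy repx (λ i → sym (eq i))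

hypotheses : {n₁ n : ℕ} → ((2 * n₁ ≤ n × 4 ≤ 2 * n₁) ⊎ (2 * n₁ < n × 2 * n₁ ≡ 2)) →
             2 * n₁ ≤ n × 3 ≤ n × Fin n₁
hypotheses {zero} (inj₁ (_ , ()))
hypotheses {zero} (inj₂ (_ , ()))
hypotheses {suc _} (inj₁ (2n₁≤n , 4≤2n₁)) =
  2n₁≤n , ≤-trans (n≤1+n 3) (≤-trans 4≤2n₁ 2n₁≤n) , F.zero
hypotheses {suc _} {n} (inj₂ (2n₁<n , 2n₁≡2)) =
  ≤-trans (n≤1+n _) 2n₁<n , subst (λ m → suc m ≤ n) 2n₁≡2 2n₁<n , F.zero

proposition9 : (n₁ n : ℕ) (G : Graph (Fin n₁)) → Connected G →
    ((2 * n₁ ≤ n × 4 ≤ 2 * n₁) ⊎ (2 * n₁ < n × 2 * n₁ ≡ 2)) →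
    PartitionDim (corona G (star n)) n
proposition9 n₁ n G connected conditions with hypotheses conditions
... | 2n₁≤n , 3≤n , c with hub-labelling 2n₁≤n
...   | ℓ , ℓ-injective =
  (Π , resolving) , λ t t<n → LowerBound.few-classes-not-resolving G connected c t<n
  where open UpperBound G c ℓ ℓ-injective 3≤n
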